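{- Let $Z_G$ be a $\Pi$-zonotope with connected graph $G$, and let $F$ and $H$ be facets of $Z_G$ corresponding to partitions $\{X_1,X_2\}$ and $\{Y_1,Y_2\}$ of the vertex set of $G$. If $F$ and $H$ lie in a common belt of $Z_G$, then one of $X_1,X_2$ is a subset of $Y_1$ or of $Y_2$. Conversely, if one of the sets $X_i\cap Y_j$ ($i,j\in\{1,2\}$) is empty and all the (nonempty) sets $X_i\cap Y_j$ induce connected subgraphs of $G$, then the corresponding facets lie in one belt.
   Context: Let $\mathbf e_i$ be standard basis vectors of $\mathbb R^{n+1}$, $\mathbf e_{ij}=\mathbf e_i-\mathbf e_j$, and for a graph $G$ on $\{1,\dots,n+1\}$ let $Z_G=\sum[\mathbf 0,\mathbf e_{ij}]$ over edges $\{i,j\}$, $i<j$, of $G$. A facet of $Z_G$ corresponds to a partition $\{X_1,X_2\}$ of the vertex set into two nonempty sets with connected induced subgraphs $G(X_1),G(X_2)$: it is a translate of the zonotope generated by the $\mathbf e_{ij}$ for edges inside $X_1$ or inside $X_2$ (the partition determines a pair of opposite facets). A belt of a zonotope is the set of all facets parallel to a given face of codimension 2. -}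

module Defs where

open import Data.Nat using (ℕ; zero; suc; _<_; _+_) renaming (_≤_ to _≤ℕ_)
open import Data.Fin using (Fin; toℕ)
open import Data.Bool using (Bool; true; false; not)
open import Data.Rational using (ℚ; 0ℚ; 1ℚ) renaming (_+_ to _+ℚ_; _*_ to _*ℚ_; -_ to -ℚ_)
open import Data.Product using (Σ; ∃; ∃-syntax; _×_; _,_)
open import Relation.Binary.PropositionalEquality using (_≡_; _≢_)
open import Relation.Nullary using (¬_)

-- A finite simple graph on the vertex set {0,…,n} = Fin (suc n)
-- (the paper's {1,…,n+1}).
record Graph (n : ℕ) : Set where
  field
    adj       : Fin (suc n) → Fin (suc n) → Bool
    adj-sym   : ∀ i j → adj i j ≡ adj j i
    adj-irr   : ∀ i → adj i i ≡ false

open Graph public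

Edge : ∀ {n} → Graph n → Fin (suc n) → Fin (suc n) → Set
Edge G i j = adj G i j ≡ true

VSet : ℕ → Set₁
VSet n = Fin (suc n) → Set

data PathIn {n} (G : Graph n) (S : VSet n) : Fin (suc n) → Fin (suc n) → Set where
  here : ∀ {u} → S u → PathIn G S u u
  step : ∀ {u w v} → S u → Edge G u w → PathIn G S w v → PathIn G S u v

InducedConnected : ∀ {n} → Graph n → VSet n → Set
InducedConnected G S = ∀ u v → S u → S v → PathIn G S u v

GraphConnected : ∀ {n} → Graph n → Set
GraphConnected {n} G = InducedConnected G (λ _ → Data.Unit.⊤)
  where import Data.Unit

NonEmpty : ∀ {n} → VSet n → Set
NonEmpty S = ∃[ v ] S v

Empty : ∀ {n} → VSet n → Set
Empty S = ∀ v → ¬ S v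

_⊆_ : ∀ {n} → VSet n → VSet n → Set
S ⊆ T = ∀ v → S v → T v

_∩_ : ∀ {n} → VSet n → VSet n → VSet n
(S ∩ T) v = S v × T v

-- a two-block partition {X₁,X₂} is encoded by X : Fin (suc n) → Bool,
-- with blocks  part X true = X₁  and  part X false = X₂.
part : ∀ {n} → (Fin (suc n) → Bool) → Bool → VSet n
part X b v = X v ≡ b

-- {X₁,X₂} determines a (pair of opposite) facet(s) of Z_G:
-- both blocks nonempty with connected induced subgraphs.
IsFacetPartition : ∀ {n} → Graph n → (Fin (suc n) → Bool) → Set
IsFacetPartition G X = ∀ b → NonEmpty (part X b) × InducedConnected G (part X b)

QVec : ℕ → Set
QVec n = Fin (suc n) → ℚ

_≈v_ : ∀ {n} → QVec n → QVec n → Set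
v ≈v w = ∀ k → v k ≡ w k

zeroV : ∀ {n} → QVec n
zeroV _ = 0ℚ

sumFin : ∀ d → (Fin d → ℚ) → ℚ
sumFin zero    f = 0ℚ
sumFin (suc d) f = f Fin.zero +ℚ sumFin d (λ l → f (Fin.suc l))
  where import Data.Fin as Fin

lincomb : ∀ {n} d → (Fin d → ℚ) → (Fin d → QVec n) → QVec n
lincomb d a vs k = sumFin d (λ l → a l *ℚ vs l k)

basis : ∀ {n} → Fin (suc n) → QVec n
basis i k with i Data.Fin.≟ k
  where import Data.Fin
... | Relation.Nullary.yes _ = 1ℚ
  where import Relation.Nullary
... | Relation.Nullary.no _ = 0ℚ
  where import Relation.Nullary

eij : ∀ {n} → Fin (suc n) → Fin (suc n) → QVec n
eij i j k = basis i k +ℚ (-ℚ basis j k)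

Subspace : ℕ → Set₁
Subspace n = QVec n → Set

EdgeSpan : ∀ {n} → Graph n → (Fin (suc n) → Fin (suc n) → Set) → Subspace n
EdgeSpan {n} G P v =
  ∃[ m ] Σ (Fin m → ℚ) λ a → Σ (Fin m → Fin (suc n)) λ is → Σ (Fin m → Fin (suc n)) λ js →
    (∀ l → Edge G (is l) (js l) × toℕ (is l) < toℕ (js l) × P (is l) (js l))
    × (v ≈v lincomb m a (λ l → eij (is l) (js l)))

LinIndep : ∀ {n} d → (Fin d → QVec n) → Set
LinIndep d vs = ∀ (a : Fin d → ℚ) → lincomb d a vs ≈v zeroV → ∀ l → a l ≡ 0ℚ

HasDim : ∀ {n} → Subspace n → ℕ → Set
HasDim {n} V d =
  (Σ (Fin d → QVec n) λ vs → (∀ l → V (vs l)) × LinIndep d vs)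
  × (∀ (vs : Fin (suc d) → QVec n) → (∀ l → V (vs l)) → ¬ LinIndep (suc d) vs)

ZDir : ∀ {n} → Graph n → Subspace n
ZDir G = EdgeSpan G (λ _ _ → Data.Unit.⊤)
  where import Data.Unit

-- direction of the face of Z_G = Σ [0,e_ij] maximising the linear
-- functional c: it is spanned by the generators e_ij with c·e_ij = 0,
-- i.e. c i = c j.
FaceDir : ∀ {n} → Graph n → QVec n → Subspace n
FaceDir G c = EdgeSpan G (λ i j → c i ≡ c j)

FacetDir : ∀ {n} → Graph n → (Fin (suc n) → Bool) → Subspace n
FacetDir G X = EdgeSpan G (λ i j → X i ≡ X j)

Codim2 : ∀ {n} → Graph n → QVec n → Set
Codim2 G c = ∃[ d ] HasDim (FaceDir G c) d × HasDim (ZDir G) (d + 2)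

ParallelTo : ∀ {n} → Graph n → (Fin (suc n) → Bool) → QVec n → Set
ParallelTo G X c = ∀ v → FaceDir G c v → FacetDir G X v

CommonBelt : ∀ {n} → Graph n → (Fin (suc n) → Bool) → (Fin (suc n) → Bool) → Set
CommonBelt G X Y = ∃[ c ] Codim2 G c × ParallelTo G X c × ParallelTo G Y c

-- The face of Z_G on which a functional c is maximal is spanned by the e_ij over the edges with
-- c i = c j. If these are exactly the edges inside the k classes of a partition of the vertices
-- into connected pieces, the face has dimension n + 1 - k: choosing a root in each class, the
-- e_{root, v} over the other vertices v form a basis. In particular Z_G has dimension n.
-- A face parallel to the facets of {X₁,X₂} and {Y₁,Y₂} only contains edges inside the cells
-- X_i ∩ Y_j, so if all four cells are nonempty it has codimension at least 3. Conversely, if a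
-- cell X_i ∩ Y_j is empty, the three connected pieces X_i, Y_j and X_¬i ∩ Y_¬j give a face of
-- codimension 2 parallel to both facets; if the opposite cell is empty too, Y is X up to
-- complement, and splitting a block of X into a non-cut vertex of its induced subgraph and the
-- rest does it.
module Submission where

open import Defs
open import Data.Nat using (ℕ; zero; suc; _+_; _⊔_; _<_; _≤_; z≤n; s≤s)
import Data.Nat.Properties as NP
open import Data.Fin using (Fin; toℕ; punchIn)
import Data.Fin as F
import Data.Fin.Properties as FP
open import Data.Bool using (Bool; true; false; not)
import Data.Bool as B
import Data.Bool.Properties as BP
open import Data.Rational using (ℚ; 0ℚ; 1ℚ) renaming (_+_ to _+ℚ_; _*_ to _*ℚ_; -_ to -ℚ_)
import Data.Rational as Q
import Data.Rational.Properties as QP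
open import Data.Vec.Functional using (insertAt; _∷_; [])
open import Data.Vec.Functional.Properties using (insertAt-lookup; insertAt-punchIn)
open import Data.Unit using (tt)
open import Data.Sum using (inj₁; inj₂)
open import Data.Product using (Σ; ∃; ∃-syntax; _×_; _,_; proj₁; proj₂)
open import Function using (_∘_; Inverse)
open import Function.Definitions using (Injective)
open import Relation.Nullary using (¬_; Dec; yes; no; ¬?; does; _×-dec_; _→-dec_; contradiction)
open import Relation.Nullary.Decidable using (dec⇒maybe; decidable-stable; dec-true; dec-false)
open import Relation.Binary using (DecidableEquality; tri<; tri≈; tri>)
open import Relation.Binary.PropositionalEquality
open import Tactic.RingSolver.Core.AlmostCommutativeRing using (AlmostCommutativeRing; fromCommutativeRing)
open import Tactic.RingSolver using (solve-∀)
open ≡-Reasoning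

ℚ-ring : AlmostCommutativeRing _ _
ℚ-ring = fromCommutativeRing QP.+-*-commutativeRing (λ x → dec⇒maybe (0ℚ Q.≟ x))

sumFin-cong : ∀ d {f g : Fin d → ℚ} → (∀ l → f l ≡ g l) → sumFin d f ≡ sumFin d g
sumFin-cong zero    f≗g = refl
sumFin-cong (suc d) f≗g = cong₂ _+ℚ_ (f≗g F.zero) (sumFin-cong d (f≗g ∘ F.suc))

sumFin-zero : ∀ d {f : Fin d → ℚ} → (∀ l → f l ≡ 0ℚ) → sumFin d f ≡ 0ℚ
sumFin-zero zero    f≗0 = refl
sumFin-zero (suc d) f≗0 = cong₂ _+ℚ_ (f≗0 F.zero) (sumFin-zero d (f≗0 ∘ F.suc))

sumFin-+ : ∀ d (f g : Fin d → ℚ) → sumFin d (λ l → f l +ℚ g l) ≡ sumFin d f +ℚ sumFin d g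
sumFin-+ zero    f g = refl
sumFin-+ (suc d) f g = begin
  (f F.zero +ℚ g F.zero) +ℚ sumFin d (λ l → f (F.suc l) +ℚ g (F.suc l))
    ≡⟨ cong ((f F.zero +ℚ g F.zero) +ℚ_) (sumFin-+ d (f ∘ F.suc) (g ∘ F.suc)) ⟩
  (f F.zero +ℚ g F.zero) +ℚ (sumFin d (f ∘ F.suc) +ℚ sumFin d (g ∘ F.suc))
    ≡⟨ interchange (f F.zero) (g F.zero) _ _ ⟩
  (f F.zero +ℚ sumFin d (f ∘ F.suc)) +ℚ (g F.zero +ℚ sumFin d (g ∘ F.suc)) ∎
  where
  interchange : ∀ a b c e → (a +ℚ b) +ℚ (c +ℚ e) ≡ (a +ℚ c) +ℚ (b +ℚ e)
  interchange = solve-∀ ℚ-ring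

sumFin-*ˡ : ∀ d (c : ℚ) (f : Fin d → ℚ) → sumFin d (λ l → c *ℚ f l) ≡ c *ℚ sumFin d f
sumFin-*ˡ zero    c f = sym (QP.*-zeroʳ c)
sumFin-*ˡ (suc d) c f = begin
  c *ℚ f F.zero +ℚ sumFin d (λ l → c *ℚ f (F.suc l))
    ≡⟨ cong (c *ℚ f F.zero +ℚ_) (sumFin-*ˡ d c (f ∘ F.suc)) ⟩
  c *ℚ f F.zero +ℚ c *ℚ sumFin d (f ∘ F.suc)
    ≡⟨ QP.*-distribˡ-+ c _ _ ⟨
  c *ℚ sumFin (suc d) f ∎

sumFin-neg : ∀ d (f : Fin d → ℚ) → sumFin d (λ l → -ℚ f l) ≡ -ℚ sumFin d f
sumFin-neg d f = begin
  sumFin d (λ l → -ℚ f l)          ≡⟨ sumFin-cong d (λ l → neg-as-* (f l)) ⟩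
  sumFin d (λ l → (-ℚ 1ℚ) *ℚ f l) ≡⟨ sumFin-*ˡ d (-ℚ 1ℚ) f ⟩
  (-ℚ 1ℚ) *ℚ sumFin d f           ≡⟨ neg-as-* (sumFin d f) ⟨
  -ℚ sumFin d f                    ∎
  where
  neg-as-* : ∀ x → -ℚ x ≡ (-ℚ 1ℚ) *ℚ x
  neg-as-* = solve-∀ ℚ-ring

sumFin-swap : ∀ d e (h : Fin d → Fin e → ℚ) →
  sumFin d (λ l → sumFin e (h l)) ≡ sumFin e (λ k → sumFin d (λ l → h l k))
sumFin-swap zero    e h = sym (sumFin-zero e (λ _ → refl))
sumFin-swap (suc d) e h = begin
  sumFin e (h F.zero) +ℚ sumFin d (λ l → sumFin e (h (F.suc l)))
    ≡⟨ cong (sumFin e (h F.zero) +ℚ_) (sumFin-swap d e (h ∘ F.suc)) ⟩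
  sumFin e (h F.zero) +ℚ sumFin e (λ k → sumFin d (λ l → h (F.suc l) k))
    ≡⟨ sumFin-+ e _ _ ⟨
  sumFin e (λ k → sumFin (suc d) (λ l → h l k)) ∎

sumFin-single : ∀ d (f : Fin d → ℚ) p → (∀ l → l ≢ p → f l ≡ 0ℚ) → sumFin d f ≡ f p
sumFin-single (suc d) f F.zero f≗0 = begin
  f F.zero +ℚ sumFin d (f ∘ F.suc) ≡⟨ cong (f F.zero +ℚ_) (sumFin-zero d (λ l → f≗0 (F.suc l) λ ())) ⟩
  f F.zero +ℚ 0ℚ                   ≡⟨ QP.+-identityʳ _ ⟩
  f F.zero                         ∎
sumFin-single (suc d) f (F.suc p) f≗0 = begin
  f F.zero +ℚ sumFin d (f ∘ F.suc)
    ≡⟨ cong₂ _+ℚ_ (f≗0 F.zero λ ())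
                  (sumFin-single d (f ∘ F.suc) p (λ l l≢p → f≗0 (F.suc l) (l≢p ∘ FP.suc-injective))) ⟩
  0ℚ +ℚ f (F.suc p) ≡⟨ QP.+-identityˡ _ ⟩
  f (F.suc p)       ∎

sumFin-punchIn : ∀ m (f : Fin (suc m) → ℚ) p → sumFin (suc m) f ≡ f p +ℚ sumFin m (f ∘ punchIn p)
sumFin-punchIn m       f F.zero    = refl
sumFin-punchIn (suc m) f (F.suc p) = begin
  f F.zero +ℚ sumFin (suc m) (f ∘ F.suc)
    ≡⟨ cong (f F.zero +ℚ_) (sumFin-punchIn m (f ∘ F.suc) p) ⟩
  f F.zero +ℚ (f (F.suc p) +ℚ sumFin m (f ∘ F.suc ∘ punchIn p))
    ≡⟨ left-comm (f F.zero) (f (F.suc p)) _ ⟩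
  f (F.suc p) +ℚ (f F.zero +ℚ sumFin m (f ∘ F.suc ∘ punchIn p)) ∎
  where
  left-comm : ∀ a b c → a +ℚ (b +ℚ c) ≡ b +ℚ (a +ℚ c)
  left-comm = solve-∀ ℚ-ring

basis-diagonal : ∀ {n} (i : Fin (suc n)) → basis i i ≡ 1ℚ
basis-diagonal i with i F.≟ i
... | yes _   = refl
... | no i≢i = contradiction refl i≢i

basis-offDiagonal : ∀ {n} {i k : Fin (suc n)} → i ≢ k → basis i k ≡ 0ℚ
basis-offDiagonal {i = i} {k} i≢k with i F.≟ k
... | yes i≡k = contradiction i≡k i≢k
... | no _    = refl

sumFin-*basis : ∀ {n} (g : QVec n) i → sumFin (suc n) (λ k → g k *ℚ basis i k) ≡ g i
sumFin-*basis {n} g i = begin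
  sumFin (suc n) (λ k → g k *ℚ basis i k)
    ≡⟨ sumFin-single (suc n) _ i (λ k k≢i →
         trans (cong (g k *ℚ_) (basis-offDiagonal (k≢i ∘ sym))) (QP.*-zeroʳ (g k))) ⟩
  g i *ℚ basis i i ≡⟨ cong (g i *ℚ_) (basis-diagonal i) ⟩
  g i *ℚ 1ℚ        ≡⟨ QP.*-identityʳ (g i) ⟩
  g i              ∎

*-≢0 : ∀ {x y : ℚ} → x ≢ 0ℚ → y ≢ 0ℚ → x *ℚ y ≢ 0ℚ
*-≢0 {x} {y} x≢0 y≢0 xy≡0 = y≢0 (begin
  y                        ≡⟨ QP.*-identityˡ y ⟨
  1ℚ *ℚ y                  ≡⟨ cong (_*ℚ y) (QP.*-inverseˡ x) ⟨
  (Q.1/ x) *ℚ x *ℚ y       ≡⟨ QP.*-assoc (Q.1/ x) x y ⟩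
  (Q.1/ x) *ℚ (x *ℚ y)     ≡⟨ cong ((Q.1/ x) *ℚ_) xy≡0 ⟩
  (Q.1/ x) *ℚ 0ℚ           ≡⟨ QP.*-zeroʳ (Q.1/ x) ⟩
  0ℚ                       ∎)
  where instance _ = Q.≢-nonZero x≢0

sumFin-linear : ∀ d (b A B : Fin d → ℚ) α β →
  sumFin d (λ l → b l *ℚ (α *ℚ A l +ℚ β *ℚ B l))
    ≡ α *ℚ sumFin d (λ l → b l *ℚ A l) +ℚ β *ℚ sumFin d (λ l → b l *ℚ B l)
sumFin-linear d b A B α β = begin
  sumFin d (λ l → b l *ℚ (α *ℚ A l +ℚ β *ℚ B l))
    ≡⟨ sumFin-cong d (λ l → distrib (b l) (A l) (B l) α β) ⟩
  sumFin d (λ l → α *ℚ (b l *ℚ A l) +ℚ β *ℚ (b l *ℚ B l))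
    ≡⟨ sumFin-+ d _ _ ⟩
  sumFin d (λ l → α *ℚ (b l *ℚ A l)) +ℚ sumFin d (λ l → β *ℚ (b l *ℚ B l))
    ≡⟨ cong₂ _+ℚ_ (sumFin-*ˡ d α _) (sumFin-*ˡ d β _) ⟩
  α *ℚ sumFin d (λ l → b l *ℚ A l) +ℚ β *ℚ sumFin d (λ l → b l *ℚ B l) ∎
  where
  distrib : ∀ b A B α β → b *ℚ (α *ℚ A +ℚ β *ℚ B) ≡ α *ℚ (b *ℚ A) +ℚ β *ℚ (b *ℚ B)
  distrib = solve-∀ ℚ-ring

-- w l k is the k-th coordinate of the l-th of d vectors in ℚ^m.
Annihilates : ∀ {m} d → (Fin d → ℚ) → (Fin d → Fin m → ℚ) → Set
Annihilates d a w = ∀ k → sumFin d (λ l → a l *ℚ w l k) ≡ 0ℚ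

NontrivialRelation : ∀ {m} d → (Fin d → Fin m → ℚ) → Set
NontrivialRelation d w = Σ (Fin d → ℚ) λ a → Annihilates d a w × ∃ λ l → a l ≢ 0ℚ

relation-zeroColumn : ∀ {m} (w : Fin (suc (suc m)) → Fin (suc m) → ℚ) → (∀ l → w l F.zero ≡ 0ℚ) →
  NontrivialRelation (suc m) (λ l k → w (F.suc l) (F.suc k)) → NontrivialRelation (suc (suc m)) w
relation-zeroColumn {m} w column≡0 (b , b-annihilates , l , bₗ≢0) = 0ℚ ∷ b , annihilates , F.suc l , bₗ≢0
  where
  annihilates : Annihilates (suc (suc m)) (0ℚ ∷ b) w
  annihilates F.zero    = cong₂ _+ℚ_ (QP.*-zeroˡ (w F.zero F.zero))
    (sumFin-zero (suc m) (λ l → trans (cong (b l *ℚ_) (column≡0 (F.suc l))) (QP.*-zeroʳ (b l))))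
  annihilates (F.suc k) = cong₂ _+ℚ_ (QP.*-zeroˡ (w F.zero (F.suc k))) (b-annihilates k)

-- One step of Gaussian elimination with pivot w p 0.
module Pivot {m} (w : Fin (suc (suc m)) → Fin (suc m) → ℚ) (p : Fin (suc (suc m))) where

  π : ℚ
  π = w p F.zero

  row : Fin (suc m) → Fin (suc m) → ℚ
  row l = w (punchIn p l)

  reduced : Fin (suc m) → Fin (suc m) → ℚ
  reduced l x = π *ℚ row l x +ℚ (-ℚ w p x) *ℚ row l F.zero

  reduced-column₀ : ∀ l → reduced l F.zero ≡ 0ℚ
  reduced-column₀ l = cancel π (row l F.zero)
    where
    cancel : ∀ π r → π *ℚ r +ℚ (-ℚ π) *ℚ r ≡ 0ℚ
    cancel = solve-∀ ℚ-ring

  lift : (Fin (suc m) → ℚ) → Fin (suc (suc m)) → ℚ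
  lift b = insertAt (λ l → b l *ℚ π) p (-ℚ sumFin (suc m) (λ l → b l *ℚ row l F.zero))

  lift-annihilates : ∀ b → Annihilates (suc m) b (λ l k → reduced l (F.suc k)) →
    Annihilates (suc (suc m)) (lift b) w
  lift-annihilates b b-annihilates x = begin
    sumFin (suc (suc m)) (λ L → lift b L *ℚ w L x)
      ≡⟨ sumFin-punchIn (suc m) (λ L → lift b L *ℚ w L x) p ⟩
    lift b p *ℚ w p x +ℚ sumFin (suc m) (λ l → lift b (punchIn p l) *ℚ row l x)
      ≡⟨ cong₂ _+ℚ_ (cong (_*ℚ w p x) (insertAt-lookup (λ l → b l *ℚ π) p (-ℚ S₀)))
                    (sumFin-cong (suc m) (λ l →
                      cong (_*ℚ row l x) (insertAt-punchIn (λ l → b l *ℚ π) p (-ℚ S₀) l))) ⟩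
    (-ℚ S₀) *ℚ w p x +ℚ sumFin (suc m) (λ l → b l *ℚ π *ℚ row l x)
      ≡⟨ cong ((-ℚ S₀) *ℚ w p x +ℚ_) (trans (sumFin-cong (suc m) (λ l → factor (b l) π (row l x)))
                                           (sumFin-*ˡ (suc m) π (λ l → b l *ℚ row l x))) ⟩
    (-ℚ S₀) *ℚ w p x +ℚ π *ℚ Sₓ
      ≡⟨ rearrange S₀ (w p x) π Sₓ ⟩
    π *ℚ Sₓ +ℚ (-ℚ w p x) *ℚ S₀
      ≡⟨ sumFin-linear (suc m) b (λ l → row l x) (λ l → row l F.zero) π (-ℚ w p x) ⟨
    sumFin (suc m) (λ l → b l *ℚ reduced l x)
      ≡⟨ annihilates-reduced x ⟩
    0ℚ ∎
    where
    S₀ Sₓ : ℚ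
    S₀ = sumFin (suc m) (λ l → b l *ℚ row l F.zero)
    Sₓ = sumFin (suc m) (λ l → b l *ℚ row l x)
    rearrange : ∀ S₀ wₚ π Sₓ → (-ℚ S₀) *ℚ wₚ +ℚ π *ℚ Sₓ ≡ π *ℚ Sₓ +ℚ (-ℚ wₚ) *ℚ S₀
    rearrange = solve-∀ ℚ-ring
    factor : ∀ b π r → b *ℚ π *ℚ r ≡ π *ℚ (b *ℚ r)
    factor = solve-∀ ℚ-ring
    annihilates-reduced : Annihilates (suc m) b reduced
    annihilates-reduced F.zero    =
      sumFin-zero (suc m) (λ l → trans (cong (b l *ℚ_) (reduced-column₀ l)) (QP.*-zeroʳ (b l)))
    annihilates-reduced (F.suc k) = b-annihilates k

  lift-nonzero : π ≢ 0ℚ → ∀ b l → b l ≢ 0ℚ → lift b (punchIn p l) ≢ 0ℚ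
  lift-nonzero π≢0 b l bₗ≢0 =
    subst (_≢ 0ℚ) (sym (insertAt-punchIn (λ l → b l *ℚ π) p _ l)) (*-≢0 bₗ≢0 π≢0)

nontrivialRelation : ∀ m (w : Fin (suc m) → Fin m → ℚ) → NontrivialRelation (suc m) w
nontrivialRelation zero    w = (λ _ → 1ℚ) , (λ ()) , F.zero , QP.1≢0
nontrivialRelation (suc m) w with FP.any? (λ p → ¬? (w p F.zero Q.≟ 0ℚ))
... | no noPivot = relation-zeroColumn w column₀≡0 (nontrivialRelation m (λ l k → w (F.suc l) (F.suc k)))
  where
  column₀≡0 : ∀ l → w l F.zero ≡ 0ℚ
  column₀≡0 l = decidable-stable (w l F.zero Q.≟ 0ℚ) (noPivot ∘ (l ,_))
... | yes (p , π≢0) with nontrivialRelation m (λ l k → reduced l (F.suc k))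
  where open Pivot w p
...   | b , b-annihilates , l , bₗ≢0 =
  lift b , lift-annihilates b b-annihilates , punchIn p l , lift-nonzero π≢0 b l bₗ≢0
  where open Pivot w p

LinIndep-tail : ∀ {n} m (vs : Fin (suc m) → QVec n) → LinIndep (suc m) vs → LinIndep m (vs ∘ F.suc)
LinIndep-tail m vs indep a a-relation l = indep (0ℚ ∷ a) relation (F.suc l)
  where
  relation : lincomb (suc m) (0ℚ ∷ a) vs ≈v zeroV
  relation k = trans (cong (_+ℚ lincomb m a (vs ∘ F.suc) k) (QP.*-zeroˡ (vs F.zero k)))
                     (trans (QP.+-identityˡ _) (a-relation k))

LinIndep⇒≤ : ∀ {n} {V : Subspace n} {c} →
  (∀ (vs : Fin (suc c) → QVec n) → (∀ l → V (vs l)) → ¬ LinIndep (suc c) vs) →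
  ∀ m (vs : Fin m → QVec n) → (∀ l → V (vs l)) → LinIndep m vs → m ≤ c
LinIndep⇒≤ dependent zero    vs vs∈V indep = z≤n
LinIndep⇒≤ {V = V} dependent (suc m) vs vs∈V indep
  with NP.m≤n⇒m<n∨m≡n (LinIndep⇒≤ {V = V} dependent m (vs ∘ F.suc) (vs∈V ∘ F.suc) (LinIndep-tail m vs indep))
... | inj₁ m<c  = m<c
... | inj₂ refl = contradiction indep (dependent vs vs∈V)

HasDim-unique : ∀ {n} {V : Subspace n} {d e} → HasDim V d → HasDim V e → d ≡ e
HasDim-unique {V = V} ((us , us∈V , us-indep) , d-max) ((vs , vs∈V , vs-indep) , e-max) =
  NP.≤-antisym (LinIndep⇒≤ {V = V} e-max _ us us∈V us-indep) (LinIndep⇒≤ {V = V} d-max _ vs vs∈V vs-indep)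

module _ {n} {G : Graph n} where

  PathIn-start : ∀ {S : VSet n} {u v} → PathIn G S u v → S u
  PathIn-start (here su)     = su
  PathIn-start (step su _ _) = su

  PathIn-map : ∀ {S T : VSet n} → S ⊆ T → ∀ {u v} → PathIn G S u v → PathIn G T u v
  PathIn-map S⊆T (here su)        = here (S⊆T _ su)
  PathIn-map S⊆T (step su e path) = step (S⊆T _ su) e (PathIn-map S⊆T path)

  _++ₚ_ : ∀ {S : VSet n} {u v w} → PathIn G S u v → PathIn G S v w → PathIn G S u w
  here _         ++ₚ q = q
  step su e path ++ₚ q = step su e (path ++ₚ q)

  PathIn-reverse : ∀ {S : VSet n} {u v} → PathIn G S u v → PathIn G S v u
  PathIn-reverse (here su) = here su
  PathIn-reverse (step {u} {w} su e path) =
    PathIn-reverse path ++ₚ step (PathIn-start path) (trans (adj-sym G w u) e) (here su)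

  InducedConnected-⊆⊇ : ∀ {S T : VSet n} → S ⊆ T → T ⊆ S → InducedConnected G S → InducedConnected G T
  InducedConnected-⊆⊇ S⊆T T⊆S connected u v tu tv = PathIn-map S⊆T (connected u v (T⊆S u tu) (T⊆S v tv))

module _ {n} (G : Graph n) where

  EdgeSpan-mono : ∀ {P Q : Fin (suc n) → Fin (suc n) → Set} → (∀ i j → P i j → Q i j) →
    ∀ {v} → EdgeSpan G P v → EdgeSpan G Q v
  EdgeSpan-mono P⇒Q (m , a , is , js , gens , v≈) =
    m , a , is , js , (λ l → let e , i<j , p = gens l in e , i<j , P⇒Q _ _ p) , v≈

  module _ {P : Fin (suc n) → Fin (suc n) → Set} where

    EdgeSpan-eij-self : ∀ u → EdgeSpan G P (eij u u)
    EdgeSpan-eij-self u = 0 , (λ ()) , (λ ()) , (λ ()) , (λ ()) , (λ k → QP.+-inverseʳ (basis u k))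

    EdgeSpan-≈ : ∀ {v w} → v ≈v w → EdgeSpan G P v → EdgeSpan G P w
    EdgeSpan-≈ v≈w (m , a , is , js , gens , v≈) = m , a , is , js , gens , (λ k → trans (sym (v≈w k)) (v≈ k))

    EdgeSpan-cons : ∀ {i j v} α → Edge G i j → toℕ i < toℕ j → P i j →
      EdgeSpan G P v → EdgeSpan G P (λ k → α *ℚ eij i j k +ℚ v k)
    EdgeSpan-cons {i} {j} α e i<j p (m , a , is , js , gens , v≈) =
      suc m , α ∷ a , i ∷ is , j ∷ js , (λ { F.zero → e , i<j , p ; (F.suc l) → gens l }) ,
      (λ k → cong (α *ℚ eij i j k +ℚ_) (v≈ k))

    -- e_uv = e_uw + e_wv, where the generator for the edge {u,w} is e_uw or e_wu = -e_uw.
    EdgeSpan-step : ∀ {u w v} → Edge G u w → P u w → P w u →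
      EdgeSpan G P (eij w v) → EdgeSpan G P (eij u v)
    EdgeSpan-step {u} {w} {v} e puw pwu wv∈ with FP.<-cmp u w
    ... | tri< u<w _ _ = EdgeSpan-≈ (λ k → split k) (EdgeSpan-cons 1ℚ e u<w puw wv∈)
      where
      split : ∀ k → 1ℚ *ℚ eij u w k +ℚ eij w v k ≡ eij u v k
      split k = telescope (basis u k) (basis w k) (basis v k)
        where
        telescope : ∀ x y z → 1ℚ *ℚ (x +ℚ -ℚ y) +ℚ (y +ℚ -ℚ z) ≡ x +ℚ -ℚ z
        telescope = solve-∀ ℚ-ring
    ... | tri> _ _ w<u = EdgeSpan-≈ (λ k → split k) (EdgeSpan-cons (-ℚ 1ℚ) (trans (adj-sym G w u) e) w<u pwu wv∈)
      where
      split : ∀ k → (-ℚ 1ℚ) *ℚ eij w u k +ℚ eij w v k ≡ eij u v k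
      split k = telescope (basis u k) (basis w k) (basis v k)
        where
        telescope : ∀ x y z → (-ℚ 1ℚ) *ℚ (y +ℚ -ℚ x) +ℚ (y +ℚ -ℚ z) ≡ x +ℚ -ℚ z
        telescope = solve-∀ ℚ-ring
    ... | tri≈ _ refl _ = contradiction (trans (sym e) (adj-irr G u)) λ ()

    edge∈EdgeSpan : ∀ {i j} → Edge G i j → P i j → P j i → EdgeSpan G P (eij i j)
    edge∈EdgeSpan {j = j} e pij pji = EdgeSpan-step {v = j} e pij pji (EdgeSpan-eij-self j)

    PathIn⇒EdgeSpan : ∀ {S : VSet n} → (∀ {i j} → S i → S j → P i j) →
      ∀ {u v} → PathIn G S u v → EdgeSpan G P (eij u v)
    PathIn⇒EdgeSpan S⇒P (here {u} _)   = EdgeSpan-eij-self u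
    PathIn⇒EdgeSpan S⇒P (step {v = v} su e path) =
      EdgeSpan-step {v = v} e (S⇒P su (PathIn-start path)) (S⇒P (PathIn-start path) su) (PathIn⇒EdgeSpan S⇒P path)

indicator : ∀ {A : Set} → Dec A → ℚ
indicator (yes _) = 1ℚ
indicator (no _)  = 0ℚ

module ClassSum {n} {L : Set} (_≟_ : DecidableEquality L) (lab : Fin (suc n) → L) where

  χ : L → QVec n
  χ t k = indicator (lab k ≟ t)

  χ-member : ∀ {t k} → lab k ≡ t → χ t k ≡ 1ℚ
  χ-member {t} {k} labₖ≡t with lab k ≟ t
  ... | yes _      = refl
  ... | no labₖ≢t = contradiction labₖ≡t labₖ≢t

  χ-nonmember : ∀ {t k} → lab k ≢ t → χ t k ≡ 0ℚ
  χ-nonmember {t} {k} labₖ≢t with lab k ≟ t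
  ... | yes labₖ≡t = contradiction labₖ≡t labₖ≢t
  ... | no _       = refl

  classSum : L → QVec n → ℚ
  classSum t u = sumFin (suc n) (λ k → χ t k *ℚ u k)

  classSum-single : ∀ {t} u x → lab x ≡ t → (∀ k → lab k ≡ t → k ≢ x → u k ≡ 0ℚ) → classSum t u ≡ u x
  classSum-single {t} u x labₓ≡t others≡0 = begin
    classSum t u  ≡⟨ sumFin-single (suc n) _ x term≡0 ⟩
    χ t x *ℚ u x  ≡⟨ cong (_*ℚ u x) (χ-member labₓ≡t) ⟩
    1ℚ *ℚ u x     ≡⟨ QP.*-identityˡ (u x) ⟩
    u x           ∎
    where
    term≡0 : ∀ k → k ≢ x → χ t k *ℚ u k ≡ 0ℚ
    term≡0 k k≢x with lab k ≟ t
    ... | yes labₖ≡t = trans (QP.*-identityˡ (u k)) (others≡0 k labₖ≡t k≢x)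
    ... | no _       = QP.*-zeroˡ (u k)

  classSum-eij : ∀ t i j → classSum t (eij i j) ≡ χ t i +ℚ -ℚ χ t j
  classSum-eij t i j = begin
    sumFin (suc n) (λ k → χ t k *ℚ (basis i k +ℚ -ℚ basis j k))
      ≡⟨ sumFin-cong (suc n) (λ k → distrib (χ t k) (basis i k) (basis j k)) ⟩
    sumFin (suc n) (λ k → χ t k *ℚ basis i k +ℚ -ℚ (χ t k *ℚ basis j k))
      ≡⟨ sumFin-+ (suc n) (λ k → χ t k *ℚ basis i k) (λ k → -ℚ (χ t k *ℚ basis j k)) ⟩
    sumFin (suc n) (λ k → χ t k *ℚ basis i k) +ℚ sumFin (suc n) (λ k → -ℚ (χ t k *ℚ basis j k))
      ≡⟨ cong₂ _+ℚ_ (sumFin-*basis (χ t) i)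
                    (trans (sumFin-neg (suc n) (λ k → χ t k *ℚ basis j k)) (cong -ℚ_ (sumFin-*basis (χ t) j))) ⟩
    χ t i +ℚ -ℚ χ t j ∎
    where
    distrib : ∀ a x y → a *ℚ (x +ℚ -ℚ y) ≡ a *ℚ x +ℚ -ℚ (a *ℚ y)
    distrib = solve-∀ ℚ-ring

  classSum-lincomb : ∀ t m (a : Fin m → ℚ) (vs : Fin m → QVec n) →
    classSum t (lincomb m a vs) ≡ sumFin m (λ l → a l *ℚ classSum t (vs l))
  classSum-lincomb t m a vs = begin
    sumFin (suc n) (λ k → χ t k *ℚ sumFin m (λ l → a l *ℚ vs l k))
      ≡⟨ sumFin-cong (suc n) (λ k → sumFin-*ˡ m (χ t k) (λ l → a l *ℚ vs l k)) ⟨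
    sumFin (suc n) (λ k → sumFin m (λ l → χ t k *ℚ (a l *ℚ vs l k)))
      ≡⟨ sumFin-swap (suc n) m (λ k l → χ t k *ℚ (a l *ℚ vs l k)) ⟩
    sumFin m (λ l → sumFin (suc n) (λ k → χ t k *ℚ (a l *ℚ vs l k)))
      ≡⟨ sumFin-cong m (λ l → trans (sumFin-cong (suc n) (λ k → left-comm (χ t k) (a l) (vs l k)))
                                    (sumFin-*ˡ (suc n) (a l) (λ k → χ t k *ℚ vs l k))) ⟩
    sumFin m (λ l → a l *ℚ classSum t (vs l)) ∎
    where
    left-comm : ∀ x y z → x *ℚ (y *ℚ z) ≡ y *ℚ (x *ℚ z)
    left-comm = solve-∀ ℚ-ring

  classSum-EdgeSpan : ∀ {G : Graph n} {P} → (∀ {i j} → Edge G i j → P i j → lab i ≡ lab j) →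
    ∀ t {v} → EdgeSpan G P v → classSum t v ≡ 0ℚ
  classSum-EdgeSpan sameLabel t {v} (m , a , is , js , gens , v≈) = begin
    classSum t v
      ≡⟨ sumFin-cong (suc n) (λ k → cong (χ t k *ℚ_) (v≈ k)) ⟩
    classSum t (lincomb m a (λ l → eij (is l) (js l)))
      ≡⟨ classSum-lincomb t m a (λ l → eij (is l) (js l)) ⟩
    sumFin m (λ l → a l *ℚ classSum t (eij (is l) (js l)))
      ≡⟨ sumFin-zero m generator≡0 ⟩
    0ℚ ∎
    where
    generator≡0 : ∀ l → a l *ℚ classSum t (eij (is l) (js l)) ≡ 0ℚ
    generator≡0 l = let e , _ , p = gens l in begin
      a l *ℚ classSum t (eij (is l) (js l))  ≡⟨ cong (a l *ℚ_) (classSum-eij t (is l) (js l)) ⟩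
      a l *ℚ (χ t (is l) +ℚ -ℚ χ t (js l))
        ≡⟨ cong (λ s → a l *ℚ (χ t (is l) +ℚ -ℚ indicator (s ≟ t))) (sameLabel e p) ⟨
      a l *ℚ (χ t (is l) +ℚ -ℚ χ t (is l))   ≡⟨ cong (a l *ℚ_) (QP.+-inverseʳ (χ t (is l))) ⟩
      a l *ℚ 0ℚ                              ≡⟨ QP.*-zeroʳ (a l) ⟩
      0ℚ                                     ∎

count : ∀ m → (Fin m → Bool) → ℕ
count zero    f = 0
count (suc m) f = B.if f F.zero then suc (count m (f ∘ F.suc)) else count m (f ∘ F.suc)

prepend : ∀ {m c} b → (Fin c → Fin m) → Fin (B.if b then suc c else c) → Fin (suc m)
prepend true  g F.zero    = F.zero
prepend true  g (F.suc k) = F.suc (g k)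
prepend false g k         = F.suc (g k)

enumerate : ∀ m (f : Fin m → Bool) → Fin (count m f) → Fin m
enumerate (suc m) f = prepend (f F.zero) (enumerate m (f ∘ F.suc))

enumerate-true : ∀ m (f : Fin m → Bool) k → f (enumerate m f k) ≡ true
enumerate-true (suc m) f = prepend-true (f F.zero) refl
  where
  prepend-true : ∀ b → f F.zero ≡ b → ∀ k → f (prepend b (enumerate m (f ∘ F.suc)) k) ≡ true
  prepend-true true  f₀≡b F.zero    = f₀≡b
  prepend-true true  f₀≡b (F.suc k) = enumerate-true m (f ∘ F.suc) k
  prepend-true false f₀≡b k         = enumerate-true m (f ∘ F.suc) k

enumerate-injective : ∀ m (f : Fin m → Bool) → Injective _≡_ _≡_ (enumerate m f)
enumerate-injective (suc m) f = prepend-injective (f F.zero)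
  where
  prepend-injective : ∀ b → Injective _≡_ _≡_ (prepend b (enumerate m (f ∘ F.suc)))
  prepend-injective true  {F.zero}  {F.zero}  eq = refl
  prepend-injective true  {F.suc k} {F.suc l} eq = cong F.suc (enumerate-injective m (f ∘ F.suc) (FP.suc-injective eq))
  prepend-injective false {k}       {l}       eq = enumerate-injective m (f ∘ F.suc) (FP.suc-injective eq)

enumerate-surjective : ∀ m (f : Fin m → Bool) v → f v ≡ true → ∃ λ k → enumerate m f k ≡ v
enumerate-surjective (suc m) f = prepend-surjective (f F.zero) refl
  where
  prepend-surjective : ∀ b → f F.zero ≡ b → ∀ v → f v ≡ true → ∃ λ k → prepend b (enumerate m (f ∘ F.suc)) k ≡ v
  prepend-surjective true  f₀≡b F.zero    f₀ = F.zero , refl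
  prepend-surjective false f₀≡b F.zero    f₀ = contradiction (trans (sym f₀) f₀≡b) λ ()
  prepend-surjective true  f₀≡b (F.suc v) fᵥ =
    let k , eq = enumerate-surjective m (f ∘ F.suc) v fᵥ in F.suc k , cong F.suc eq
  prepend-surjective false f₀≡b (F.suc v) fᵥ =
    let k , eq = enumerate-surjective m (f ∘ F.suc) v fᵥ in k , cong F.suc eq

count-+-count-not : ∀ m (f : Fin m → Bool) → count m f + count m (not ∘ f) ≡ m
count-+-count-not zero    f = refl
count-+-count-not (suc m) f with f F.zero | count-+-count-not m (f ∘ F.suc)
... | true  | eq = cong suc eq
... | false | eq = trans (NP.+-suc _ _) (cong suc eq)

count-image : ∀ {m k} (f : Fin m → Bool) (e : Fin k → Fin m) → Injective _≡_ _≡_ e →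
  (∀ t → f (e t) ≡ true) → (∀ v → f v ≡ true → ∃ λ t → e t ≡ v) → count m f ≡ k
count-image {m} f e e-injective e-true e-onto = NP.≤-antisym
  (FP.injective⇒≤ {f = preimage} λ {k} {l} eq → enumerate-injective m f (begin
    enumerate m f k      ≡⟨ proj₂ (e-onto _ (enumerate-true m f k)) ⟨
    e (preimage k)       ≡⟨ cong e eq ⟩
    e (preimage l)       ≡⟨ proj₂ (e-onto _ (enumerate-true m f l)) ⟩
    enumerate m f l      ∎))
  (FP.injective⇒≤ {f = position} λ {t} {u} eq → e-injective (begin
    e t                      ≡⟨ proj₂ (enumerate-surjective m f (e t) (e-true t)) ⟨
    enumerate m f (position t) ≡⟨ cong (enumerate m f) eq ⟩
    enumerate m f (position u) ≡⟨ proj₂ (enumerate-surjective m f (e u) (e-true u)) ⟩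
    e u                      ∎))
  where
  preimage : Fin (count m f) → Fin _
  preimage k = proj₁ (e-onto (enumerate m f k) (enumerate-true m f k))
  position : Fin _ → Fin (count m f)
  position t = proj₁ (enumerate-surjective m f (e t) (e-true t))

does-true⇒ : ∀ {A : Set} (a? : Dec A) → does a? ≡ true → A
does-true⇒ (yes a) _ = a

Class : ∀ {n k} → (Fin (suc n) → Fin k) → Fin k → VSet n
Class lab t v = lab v ≡ t

ConnectedPartition : ∀ {n k} → Graph n → (Fin (suc n) → Fin k) → Set
ConnectedPartition G lab = ∀ t → NonEmpty (Class lab t) × InducedConnected G (Class lab t)

module Dimension {n k} (G : Graph n) (P : Fin (suc n) → Fin (suc n) → Set)
  (lab : Fin (suc n) → Fin k) (onto : ∀ t → NonEmpty (Class lab t)) where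

  root : Fin k → Fin (suc n)
  root t = proj₁ (onto t)

  lab-root : ∀ t → lab (root t) ≡ t
  lab-root t = proj₂ (onto t)

  isRoot : Fin (suc n) → Bool
  isRoot v = does (root (lab v) F.≟ v)

  nonRoots : ℕ
  nonRoots = count (suc n) (not ∘ isRoot)

  k+nonRoots≡ : k + nonRoots ≡ suc n
  k+nonRoots≡ = trans (cong (_+ nonRoots) (sym roots≡k)) (count-+-count-not (suc n) isRoot)
    where
    roots≡k : count (suc n) isRoot ≡ k
    roots≡k = count-image isRoot root
      (λ {t} {u} eq → trans (sym (lab-root t)) (trans (cong lab eq) (lab-root u)))
      (λ t → dec-true (root (lab (root t)) F.≟ root t) (cong root (lab-root t)))
      (λ v isRootᵥ → lab v , does-true⇒ (root (lab v) F.≟ v) isRootᵥ)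

  σ : Fin nonRoots → Fin (suc n)
  σ = enumerate (suc n) (not ∘ isRoot)

  σ-nonRoot : ∀ ℓ → root (lab (σ ℓ)) ≢ σ ℓ
  σ-nonRoot ℓ isRoot-σ = contradiction
    (trans (sym (enumerate-true (suc n) (not ∘ isRoot) ℓ)) (cong not (dec-true (root (lab (σ ℓ)) F.≟ σ ℓ) isRoot-σ)))
    λ ()

  nonRoot⇒σ : ∀ v → root (lab v) ≢ v → ∃ λ ℓ → σ ℓ ≡ v
  nonRoot⇒σ v nonRoot = enumerate-surjective (suc n) (not ∘ isRoot) v (cong not (dec-false (root (lab v) F.≟ v) nonRoot))

  -- A relation among nonRoots + 1 vectors of the span, taken on the non-root coordinates,
  -- also holds on the roots, since each class sum vanishes on the span.
  dependent : (∀ {i j} → Edge G i j → P i j → lab i ≡ lab j) →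
    ∀ (vs : Fin (suc nonRoots) → QVec n) → (∀ l → EdgeSpan G P (vs l)) → ¬ LinIndep (suc nonRoots) vs
  dependent sameLabel vs vs∈ indep with nontrivialRelation nonRoots (λ l ℓ → vs l (σ ℓ))
  ... | a , a-annihilates , l₀ , aₗ₀≢0 = aₗ₀≢0 (indep a u≈0 l₀)
    where
    open ClassSum F._≟_ lab
    u : QVec n
    u = lincomb (suc nonRoots) a vs
    u-nonRoot : ∀ x → root (lab x) ≢ x → u x ≡ 0ℚ
    u-nonRoot x nonRoot with nonRoot⇒σ x nonRoot
    ... | ℓ , refl = a-annihilates ℓ
    classSum-u : ∀ t → classSum t u ≡ 0ℚ
    classSum-u t = trans (classSum-lincomb t (suc nonRoots) a vs)
      (sumFin-zero (suc nonRoots) (λ l →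
        trans (cong (a l *ℚ_) (classSum-EdgeSpan {G = G} {P = P} sameLabel t (vs∈ l))) (QP.*-zeroʳ (a l))))
    u≈0 : u ≈v zeroV
    u≈0 x with root (lab x) F.≟ x
    ... | no nonRoot = u-nonRoot x nonRoot
    ... | yes isRootₓ = trans (sym (classSum-single u x refl others)) (classSum-u (lab x))
      where
      others : ∀ y → lab y ≡ lab x → y ≢ x → u y ≡ 0ℚ
      others y labᵧ≡labₓ y≢x = u-nonRoot y λ isRootᵧ → y≢x (trans (sym isRootᵧ) (trans (cong root labᵧ≡labₓ) isRootₓ))

  independent : (∀ {i j} → lab i ≡ lab j → P i j) → (∀ t → InducedConnected G (Class lab t)) →
    Σ (Fin nonRoots → QVec n) λ vs → (∀ ℓ → EdgeSpan G P (vs ℓ)) × LinIndep nonRoots vs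
  independent sameLabel⇒P connected = spoke , spoke∈ , spoke-independent
    where
    spoke : Fin nonRoots → QVec n
    spoke ℓ = eij (root (lab (σ ℓ))) (σ ℓ)
    spoke∈ : ∀ ℓ → EdgeSpan G P (spoke ℓ)
    spoke∈ ℓ = PathIn⇒EdgeSpan G (λ labᵢ labⱼ → sameLabel⇒P (trans labᵢ (sym labⱼ)))
      (connected (lab (σ ℓ)) (root (lab (σ ℓ))) (σ ℓ) (lab-root (lab (σ ℓ))) refl)
    root≢σ : ∀ ℓ ℓ′ → root (lab (σ ℓ′)) ≢ σ ℓ
    root≢σ ℓ ℓ′ eq = σ-nonRoot ℓ (trans (cong (root ∘ lab) (sym eq)) (trans (cong root (lab-root _)) eq))
    spoke-independent : LinIndep nonRoots spoke
    spoke-independent a relation ℓ = QP.neg-injective (trans (sym coordinate-σℓ) (relation (σ ℓ)))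
      where
      other≡0 : ∀ ℓ′ → ℓ′ ≢ ℓ → a ℓ′ *ℚ spoke ℓ′ (σ ℓ) ≡ 0ℚ
      other≡0 ℓ′ ℓ′≢ℓ = trans (cong (a ℓ′ *ℚ_) (cong₂ (λ x y → x +ℚ -ℚ y)
        (basis-offDiagonal (root≢σ ℓ ℓ′)) (basis-offDiagonal (ℓ′≢ℓ ∘ enumerate-injective (suc n) (not ∘ isRoot)))))
        (QP.*-zeroʳ (a ℓ′))
      coordinate-σℓ : lincomb nonRoots a spoke (σ ℓ) ≡ -ℚ a ℓ
      coordinate-σℓ = begin
        lincomb nonRoots a spoke (σ ℓ)   ≡⟨ sumFin-single nonRoots _ ℓ other≡0 ⟩
        a ℓ *ℚ spoke ℓ (σ ℓ)
          ≡⟨ cong (a ℓ *ℚ_) (cong₂ (λ x y → x +ℚ -ℚ y) (basis-offDiagonal (root≢σ ℓ ℓ)) (basis-diagonal (σ ℓ))) ⟩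
        a ℓ *ℚ (0ℚ +ℚ -ℚ 1ℚ)            ≡⟨ times-minus-one (a ℓ) ⟩
        -ℚ a ℓ                          ∎
        where
        times-minus-one : ∀ x → x *ℚ (0ℚ +ℚ -ℚ 1ℚ) ≡ -ℚ x
        times-minus-one = solve-∀ ℚ-ring

EdgeSpan-dim≤ : ∀ {n k} (G : Graph n) {P : Fin (suc n) → Fin (suc n) → Set} (lab : Fin (suc n) → Fin k) →
  (∀ t → NonEmpty (Class lab t)) → (∀ {i j} → Edge G i j → P i j → lab i ≡ lab j) →
  ∀ {d} (vs : Fin d → QVec n) → (∀ l → EdgeSpan G P (vs l)) → LinIndep d vs → k + d ≤ suc n
EdgeSpan-dim≤ {k = k} G {P} lab onto sameLabel {d} vs vs∈ indep =
  subst (k + d ≤_) k+nonRoots≡ (NP.+-monoʳ-≤ k (LinIndep⇒≤ {V = EdgeSpan G P} (dependent sameLabel) d vs vs∈ indep))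
  where open Dimension G P lab onto

EdgeSpan-hasDim : ∀ {n k} (G : Graph n) {P : Fin (suc n) → Fin (suc n) → Set} (lab : Fin (suc n) → Fin k) →
  ConnectedPartition G lab → (∀ {i j} → P i j → lab i ≡ lab j) → (∀ {i j} → lab i ≡ lab j → P i j) →
  ∃ λ d → k + d ≡ suc n × HasDim (EdgeSpan G P) d
EdgeSpan-hasDim G {P} lab partition P⇒sameLabel sameLabel⇒P =
  nonRoots , k+nonRoots≡ , independent sameLabel⇒P (proj₂ ∘ partition) , dependent (λ _ → P⇒sameLabel)
  where open Dimension G P lab (proj₁ ∘ partition)

ZDir-hasDim : ∀ {n} (G : Graph n) → GraphConnected G → HasDim (ZDir G) n
ZDir-hasDim {n} G connected with EdgeSpan-hasDim G oneClass partition (λ _ → refl) (λ _ → tt)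
  where
  oneClass : Fin (suc n) → Fin 1
  oneClass _ = F.zero
  partition : ConnectedPartition G oneClass
  partition F.zero = (F.zero , refl) , InducedConnected-⊆⊇ (λ _ _ → refl) (λ _ _ → tt) connected
... | d , refl , hasDim = hasDim

Refines : ∀ {n} {L M : Set} → (Fin (suc n) → L) → (Fin (suc n) → M) → Set
Refines f g = ∀ {a b} → f a ≡ f b → g a ≡ g b

ParallelTo-coarsen : ∀ {n} {G : Graph n} {X Y c} → Refines X Y → ParallelTo G X c → ParallelTo G Y c
ParallelTo-coarsen {G = G} {X} {Y} X⇒Y parallel v v∈face =
  EdgeSpan-mono G (λ i j → X⇒Y {i} {j}) (parallel v v∈face)

height : Fin 3 → ℚ
height F.zero             = 0ℚ
height (F.suc F.zero)     = 1ℚ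
height (F.suc (F.suc _))  = 1ℚ +ℚ 1ℚ

height-injective : Injective _≡_ _≡_ height
height-injective {F.zero}               {F.zero}               _ = refl
height-injective {F.suc F.zero}         {F.suc F.zero}         _ = refl
height-injective {F.suc (F.suc F.zero)} {F.suc (F.suc F.zero)} _ = refl
height-injective {F.zero}               {F.suc F.zero}         ()
height-injective {F.zero}               {F.suc (F.suc F.zero)} ()
height-injective {F.suc F.zero}         {F.zero}               ()
height-injective {F.suc F.zero}         {F.suc (F.suc F.zero)} ()
height-injective {F.suc (F.suc F.zero)} {F.zero}               ()
height-injective {F.suc (F.suc F.zero)} {F.suc F.zero}         ()

belt-from-3-partition : ∀ {n} (G : Graph n) → GraphConnected G → (lab : Fin (suc n) → Fin 3) →
  ConnectedPartition G lab → ∀ {X Y} → Refines lab X → Refines lab Y → CommonBelt G X Y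
belt-from-3-partition {n} G connected lab partition lab⇒X lab⇒Y
  with EdgeSpan-hasDim G lab partition height-injective (cong height)
... | d , 3+d≡1+n , faceDim =
  height ∘ lab , (d , faceDim , subst (HasDim (ZDir G)) n≡d+2 (ZDir-hasDim G connected)) ,
  (λ v → EdgeSpan-mono G (λ i j eq → lab⇒X {i} {j} (height-injective eq))) ,
  (λ v → EdgeSpan-mono G (λ i j eq → lab⇒Y {i} {j} (height-injective eq)))
  where
  n≡d+2 : n ≡ d + 2
  n≡d+2 = trans (NP.suc-injective (sym 3+d≡1+n)) (NP.+-comm 2 d)

ParallelTo⇒sameBlock : ∀ {n} {G : Graph n} {X c} → ParallelTo G X c →
  ∀ {i j} → Edge G i j → c i ≡ c j → X i ≡ X j
ParallelTo⇒sameBlock {G = G} {X} parallel {i} {j} e cᵢ≡cⱼ with X i B.≟ X j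
... | yes Xᵢ≡Xⱼ = Xᵢ≡Xⱼ
... | no Xᵢ≢Xⱼ  = contradiction (trans (sym classSum≡1) classSum≡0) QP.1≢0
  where
  open ClassSum B._≟_ X
  classSum≡0 : classSum (X i) (eij i j) ≡ 0ℚ
  classSum≡0 = classSum-EdgeSpan {G = G} (λ _ Xᵢ≡Xⱼ → Xᵢ≡Xⱼ) (X i)
    (parallel (eij i j) (edge∈EdgeSpan G e cᵢ≡cⱼ (sym cᵢ≡cⱼ)))
  classSum≡1 : classSum (X i) (eij i j) ≡ 1ℚ
  classSum≡1 = trans (classSum-eij (X i) i j) (cong₂ (λ x y → x +ℚ -ℚ y) (χ-member refl) (χ-nonmember (Xᵢ≢Xⱼ ∘ sym)))

cell : Bool → Bool → Fin 4
cell true  true  = F.zero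
cell true  false = F.suc F.zero
cell false true  = F.suc (F.suc F.zero)
cell false false = F.suc (F.suc (F.suc F.zero))

cell⁻¹ : Fin 4 → Bool × Bool
cell⁻¹ F.zero                      = true , true
cell⁻¹ (F.suc F.zero)              = true , false
cell⁻¹ (F.suc (F.suc F.zero))      = false , true
cell⁻¹ (F.suc (F.suc (F.suc _)))   = false , false

cell-cell⁻¹ : ∀ t → cell (proj₁ (cell⁻¹ t)) (proj₂ (cell⁻¹ t)) ≡ t
cell-cell⁻¹ F.zero                            = refl
cell-cell⁻¹ (F.suc F.zero)                    = refl
cell-cell⁻¹ (F.suc (F.suc F.zero))            = refl
cell-cell⁻¹ (F.suc (F.suc (F.suc F.zero)))    = refl

allCells⇒¬CommonBelt : ∀ {n} (G : Graph n) → GraphConnected G → ∀ {X Y} →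
  (∀ b b′ → NonEmpty (part X b ∩ part Y b′)) → ¬ CommonBelt G X Y
allCells⇒¬CommonBelt {n} G connected {X} {Y} cells (c , (d , ((vs , vs∈ , indep) , _) , ZDim) , parallelX , parallelY) =
  NP.n≮n (3 + d) (subst (4 + d ≤_) 1+n≡3+d 4+d≤1+n)
  where
  lab : Fin (suc n) → Fin 4
  lab v = cell (X v) (Y v)
  onto : ∀ t → NonEmpty (Class lab t)
  onto t with cells (proj₁ (cell⁻¹ t)) (proj₂ (cell⁻¹ t))
  ... | v , Xᵥ , Yᵥ = v , trans (cong₂ cell Xᵥ Yᵥ) (cell-cell⁻¹ t)
  4+d≤1+n : 4 + d ≤ suc n
  4+d≤1+n = EdgeSpan-dim≤ G {P = λ i j → c i ≡ c j} lab onto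
    (λ e cᵢ≡cⱼ → cong₂ cell (ParallelTo⇒sameBlock {G = G} {X = X} parallelX e cᵢ≡cⱼ)
                            (ParallelTo⇒sameBlock {G = G} {X = Y} parallelY e cᵢ≡cⱼ))
    vs vs∈ indep
  1+n≡3+d : suc n ≡ 3 + d
  1+n≡3+d = cong suc (trans (HasDim-unique {V = ZDir G} (ZDir-hasDim G connected) ZDim) (NP.+-comm d 2))

emptyCell⇒⊆ : ∀ {n} {X Y : Fin (suc n) → Bool} {b b′} → ¬ NonEmpty (part X b ∩ part Y b′) → part X b ⊆ part Y (not b′)
emptyCell⇒⊆ empty v Xᵥ = BP.¬-not (λ Yᵥ → empty (v , Xᵥ , Yᵥ))

CommonBelt⇒nested : ∀ {n} (G : Graph n) → GraphConnected G → ∀ X Y →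
  CommonBelt G X Y → ∃[ i ] ∃[ j ] (part X i ⊆ part Y j)
CommonBelt⇒nested G connected X Y belt
  with cell? true true | cell? true false | cell? false true | cell? false false
  where
  cell? : ∀ b b′ → Dec (NonEmpty (part X b ∩ part Y b′))
  cell? b b′ = FP.any? (λ v → (X v B.≟ b) ×-dec (Y v B.≟ b′))
... | no empty | _        | _        | _        = true , false , emptyCell⇒⊆ empty
... | yes _    | no empty | _        | _        = true , true , emptyCell⇒⊆ empty
... | yes _    | yes _    | no empty | _        = false , false , emptyCell⇒⊆ empty
... | yes _    | yes _    | yes _    | no empty = false , true , emptyCell⇒⊆ empty
... | yes tt′  | yes tf   | yes ft   | yes ff   = contradiction belt (allCells⇒¬CommonBelt G connected cells)
  where
  cells : ∀ b b′ → NonEmpty (part X b ∩ part Y b′)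
  cells true  true  = tt′
  cells true  false = tf
  cells false true  = ft
  cells false false = ff

Disjoint : ∀ {n k} → (Fin k → VSet n) → Set
Disjoint C = ∀ {t u v} → C t v → C u v → t ≡ u

disjoint₃ : ∀ {n} {A B D : VSet n} → (∀ {v} → A v → ¬ B v) → (∀ {v} → A v → ¬ D v) → (∀ {v} → B v → ¬ D v) →
  Disjoint (A ∷ B ∷ D ∷ [])
disjoint₃ A∩B A∩D B∩D {F.zero}                 {F.zero}                 a a′ = refl
disjoint₃ A∩B A∩D B∩D {F.suc F.zero}           {F.suc F.zero}           b b′ = refl
disjoint₃ A∩B A∩D B∩D {F.suc (F.suc F.zero)}   {F.suc (F.suc F.zero)}   d d′ = refl
disjoint₃ A∩B A∩D B∩D {F.zero}                 {F.suc F.zero}           a b  = contradiction b (A∩B a)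
disjoint₃ A∩B A∩D B∩D {F.zero}                 {F.suc (F.suc F.zero)}   a d  = contradiction d (A∩D a)
disjoint₃ A∩B A∩D B∩D {F.suc F.zero}           {F.zero}                 b a  = contradiction b (A∩B a)
disjoint₃ A∩B A∩D B∩D {F.suc F.zero}           {F.suc (F.suc F.zero)}   b d  = contradiction d (B∩D b)
disjoint₃ A∩B A∩D B∩D {F.suc (F.suc F.zero)}   {F.zero}                 d a  = contradiction d (A∩D a)
disjoint₃ A∩B A∩D B∩D {F.suc (F.suc F.zero)}   {F.suc F.zero}           d b  = contradiction d (B∩D b)

ConstantOn : ∀ {n} → (Fin (suc n) → Bool) → VSet n → Set
ConstantOn X S = ∀ {a b} → S a → S b → X a ≡ X b

belt-from-3-cover : ∀ {n} (G : Graph n) → GraphConnected G → (C : Fin 3 → VSet n) →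
  (∀ v → ∃ λ t → C t v) → Disjoint C → (∀ t → NonEmpty (C t) × InducedConnected G (C t)) →
  ∀ {X Y} → (∀ t → ConstantOn X (C t)) → (∀ t → ConstantOn Y (C t)) → CommonBelt G X Y
belt-from-3-cover G connected C cover disjoint parts constX constY =
  belt-from-3-partition G connected lab partition (refines constX) (refines constY)
  where
  lab : _ → Fin 3
  lab v = proj₁ (cover v)
  Class⊆C : ∀ t → Class lab t ⊆ C t
  Class⊆C t w refl = proj₂ (cover w)
  C⊆Class : ∀ t → C t ⊆ Class lab t
  C⊆Class t w = disjoint (proj₂ (cover w))
  partition : ConnectedPartition G lab
  partition t = let v , Cₜv = proj₁ (parts t) in
    (v , C⊆Class t v Cₜv) , InducedConnected-⊆⊇ (C⊆Class t) (Class⊆C t) (proj₂ (parts t))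
  refines : ∀ {Z} → (∀ t → ConstantOn Z (C t)) → Refines lab Z
  refines constZ {a} {b} lab-eq = constZ (lab a) (proj₂ (cover a)) (Class⊆C (lab a) b (sym lab-eq))

threshold : (Q : ℕ → Set) → (∀ k → Dec (Q k)) → ¬ Q 0 → ∀ K → Q K → ∃ λ k → ¬ Q k × Q (suc k)
threshold Q Q? ¬Q₀ zero    Q₀ = contradiction Q₀ ¬Q₀
threshold Q Q? ¬Q₀ (suc K) Q₁₊K with Q? K
... | yes Qₖ = threshold Q Q? ¬Q₀ K Qₖ
... | no ¬Qₖ = K , ¬Qₖ , Q₁₊K

uniformBound : ∀ m (Q : ℕ → Fin m → Set) → (∀ {k K v} → k ≤ K → Q k v → Q K v) →
  (∀ v → ∃ λ k → Q k v) → ∃ λ K → ∀ v → Q K v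
uniformBound zero    Q mono bounded = 0 , λ ()
uniformBound (suc m) Q mono bounded with bounded F.zero | uniformBound m (λ k → Q k ∘ F.suc) mono (bounded ∘ F.suc)
... | k₀ , Q₀ | K , Qₛ =
  k₀ ⊔ K , λ { F.zero → mono (NP.m≤m⊔n k₀ K) Q₀ ; (F.suc v) → mono (NP.m≤n⊔m k₀ K) (Qₛ v) }

-- A vertex z of S farthest from r is not a cut vertex of G(S): any other vertex w of S reaches r
-- by a walk whose vertices after w are all closer to r than z.
module NonCut {n} (G : Graph n) (S : VSet n) (S? : ∀ v → Dec (S v)) (r : Fin (suc n)) where

  data Reach : ℕ → Fin (suc n) → Set where
    arrived : ∀ {k} → Reach k r
    step    : ∀ {k w u} → S w → Edge G w u → Reach k u → Reach (suc k) w

  reach? : ∀ k w → Dec (Reach k w)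
  reach? k w with w F.≟ r
  ... | yes refl = yes arrived
  reach? zero    w | no w≢r = no λ { arrived → w≢r refl }
  reach? (suc k) w | no w≢r with S? w | FP.any? (λ u → (adj G w u B.≟ true) ×-dec reach? k u)
  ... | yes Sw | yes (u , e , reach) = yes (step Sw e reach)
  ... | no ¬Sw | _                   = no λ { arrived → w≢r refl ; (step Sw _ _) → ¬Sw Sw }
  ... | yes _  | no stuck            = no λ { arrived → w≢r refl ; (step {u = u} _ e reach) → stuck (u , e , reach) }

  Reach-≤ : ∀ {k K w} → k ≤ K → Reach k w → Reach K w
  Reach-≤ k≤K       arrived            = arrived
  Reach-≤ (s≤s k≤K) (step Sw e reach) = step Sw e (Reach-≤ k≤K reach)

  Reach-suc : ∀ {k w} → Reach k w → Reach (suc k) w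
  Reach-suc = Reach-≤ (NP.n≤1+n _)

  PathIn⇒Reach : ∀ {w} → PathIn G S w r → ∃ λ k → Reach k w
  PathIn⇒Reach (here _)          = 0 , arrived
  PathIn⇒Reach (step Sw e path) = let k , reach = PathIn⇒Reach path in suc k , step Sw e reach

  avoiding : ∀ {z j w} → S r → (∀ {u} → Reach j u → u ≢ z) → Reach j w → PathIn G (λ u → S u × u ≢ z) w r
  avoiding Sr avoids arrived            = here (Sr , avoids arrived)
  avoiding Sr avoids (step Sw e reach) = step (Sw , avoids (step Sw e reach)) e (avoiding Sr (avoids ∘ Reach-suc) reach)

  Within : ℕ → Set
  Within k = ∀ w → S w → Reach k w

  within? : ∀ k → Dec (Within k)
  within? k = FP.all? (λ w → S? w →-dec reach? k w)

  module _ (connected : InducedConnected G S) (Sr : S r) where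

    boundedDistance : ∃ λ K → Within K
    boundedDistance = uniformBound (suc n) (λ k w → S w → Reach k w) (λ k≤K reach Sw → Reach-≤ k≤K (reach Sw)) bound
      where
      bound : ∀ w → ∃ λ k → S w → Reach k w
      bound w with S? w
      ... | yes Sw = let k , reach = PathIn⇒Reach (connected w r Sw Sr) in k , λ _ → reach
      ... | no ¬Sw = 0 , λ Sw → contradiction Sw ¬Sw

    nonCutVertex : ∀ {v} → S v → v ≢ r → ∃ λ z → S z × z ≢ r × InducedConnected G (λ w → S w × w ≢ z)
    nonCutVertex {v} Sv v≢r with threshold Within within? ¬within₀ (proj₁ boundedDistance) (proj₂ boundedDistance)
      where
      ¬within₀ : ¬ Within 0
      ¬within₀ within₀ with within₀ v Sv
      ... | arrived = v≢r refl
    ... | k , ¬withinₖ , within₁₊ₖ with FP.¬∀⟶∃¬ (suc n) _ (λ w → S? w →-dec reach? k w) ¬withinₖ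
    ... | z , ¬reachᶻ = z , Sz , z≢r , λ x y Sx Sy → toRoot x Sx ++ₚ PathIn-reverse (toRoot y Sy)
      where
      Sz : S z
      Sz = decidable-stable (S? z) (λ ¬Sz → ¬reachᶻ (λ Sz → contradiction Sz ¬Sz))
      z≢r : z ≢ r
      z≢r refl = ¬reachᶻ (λ _ → arrived)
      toRoot : ∀ w → S w × w ≢ z → PathIn G (λ u → S u × u ≢ z) w r
      toRoot w (Sw , w≢z) with within₁₊ₖ w Sw
      ... | arrived        = here (Sr , λ r≡z → z≢r (sym r≡z))
      ... | step _ e reach =
        step (Sw , w≢z) e (avoiding Sr (λ reachᵘ u≡z → ¬reachᶻ (λ _ → subst (Reach k) u≡z reachᵘ)) reach)

ConstantOn-⊆ : ∀ {n} {Z : Fin (suc n) → Bool} {S : VSet n} {b} → S ⊆ part Z b → ConstantOn Z S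
ConstantOn-⊆ S⊆Z {a} {b} Sa Sb = trans (S⊆Z a Sa) (sym (S⊆Z b Sb))

twoInBlock⇒CommonBelt : ∀ {n} (G : Graph n) → GraphConnected G → ∀ {X} → IsFacetPartition G X →
  ∀ {b r v} → X r ≡ b → X v ≡ b → v ≢ r → CommonBelt G X X
twoInBlock⇒CommonBelt G connected {X} facet {b} {r} Xr Xv v≢r
  with NonCut.nonCutVertex G (part X b) (λ w → X w B.≟ b) r (proj₂ (facet b)) Xr Xv v≢r
... | z , Xz , z≢r , connected-z =
  belt-from-3-cover G connected C cover (disjoint₃ (λ (_ , w≢z) w≡z → w≢z w≡z) (λ (Xw , _) → BP.not-¬ Xw)
                                                   (λ { refl → BP.not-¬ Xz }))
    parts constant constant
  where
  C : Fin 3 → VSet _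
  C = (λ w → X w ≡ b × w ≢ z) ∷ (_≡ z) ∷ part X (not b) ∷ []
  cover : ∀ w → ∃ λ t → C t w
  cover w with X w B.≟ b | w F.≟ z
  ... | yes Xw  | no w≢z = F.zero , Xw , w≢z
  ... | yes _   | yes w≡z = F.suc F.zero , w≡z
  ... | no Xw≢b | _       = F.suc (F.suc F.zero) , BP.¬-not Xw≢b
  parts : ∀ t → NonEmpty (C t) × InducedConnected G (C t)
  parts F.zero                 = (r , Xr , z≢r ∘ sym) , connected-z
  parts (F.suc F.zero)         = (z , refl) , λ { _ _ refl refl → here refl }
  parts (F.suc (F.suc F.zero)) = facet (not b)
  constant : ∀ t → ConstantOn X (C t)
  constant F.zero                 = ConstantOn-⊆ {Z = X} (λ _ → proj₁)
  constant (F.suc F.zero)         = ConstantOn-⊆ {Z = X} (λ { _ refl → Xz })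
  constant (F.suc (F.suc F.zero)) = ConstantOn-⊆ {Z = X} (λ _ Xw → Xw)

-- With at least three vertices, some block of X has a vertex other than its chosen root.
CommonBelt-self : ∀ {n} (G : Graph n) → GraphConnected G → ∀ {X} → IsFacetPartition G X → 2 ≤ n → CommonBelt G X X
CommonBelt-self G connected {X} facet 2≤n with FP.pigeonhole (s≤s 2≤n) (Inverse.from FP.2↔Bool ∘ X)
... | i , j , i<j , same with i F.≟ root (X i)
  where
  root : Bool → Fin _
  root b = proj₁ (proj₁ (facet b))
... | no i≢root  = twoInBlock⇒CommonBelt G connected facet (proj₂ (proj₁ (facet (X i)))) refl i≢root
... | yes i≡root = twoInBlock⇒CommonBelt G connected facet (proj₂ (proj₁ (facet (X i)))) (sym Xᵢ≡Xⱼ)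
                     (λ j≡root → FP.<⇒≢ i<j (trans i≡root (sym j≡root)))
  where
  Xᵢ≡Xⱼ : X i ≡ X j
  Xᵢ≡Xⱼ = trans (sym (Inverse.strictlyInverseˡ FP.2↔Bool (X i)))
                (trans (cong (Inverse.to FP.2↔Bool) same) (Inverse.strictlyInverseˡ FP.2↔Bool (X j)))

oppositeCell⇒CommonBelt : ∀ {n} (G : Graph n) → GraphConnected G → ∀ {X Y} →
  IsFacetPartition G X → IsFacetPartition G Y → ∀ {i j} → Empty (part X i ∩ part Y j) →
  NonEmpty (part X (not i) ∩ part Y (not j)) → InducedConnected G (part X (not i) ∩ part Y (not j)) →
  CommonBelt G X Y
oppositeCell⇒CommonBelt G connected {X} {Y} facetX facetY {i} {j} empty opposite connected-opposite =
  belt-from-3-cover G connected C cover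
    (disjoint₃ (λ Xv Yv → empty _ (Xv , Yv)) (λ Xv (Xv′ , _) → BP.not-¬ Xv Xv′)
               (λ Yv (_ , Yv′) → BP.not-¬ Yv Yv′))
    parts constantX constantY
  where
  C : Fin 3 → VSet _
  C = part X i ∷ part Y j ∷ (part X (not i) ∩ part Y (not j)) ∷ []
  X_i⊆Y_¬j : part X i ⊆ part Y (not j)
  X_i⊆Y_¬j = emptyCell⇒⊆ (λ (v , cell) → empty v cell)
  Y_j⊆X_¬i : part Y j ⊆ part X (not i)
  Y_j⊆X_¬i v Yv = BP.¬-not (λ Xv → empty v (Xv , Yv))
  cover : ∀ v → ∃ λ t → C t v
  cover v with X v B.≟ i | Y v B.≟ j
  ... | yes Xv  | _       = F.zero , Xv
  ... | no _    | yes Yv  = F.suc F.zero , Yv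
  ... | no Xv≢i | no Yv≢j = F.suc (F.suc F.zero) , BP.¬-not Xv≢i , BP.¬-not Yv≢j
  parts : ∀ t → NonEmpty (C t) × InducedConnected G (C t)
  parts F.zero                 = facetX i
  parts (F.suc F.zero)         = facetY j
  parts (F.suc (F.suc F.zero)) = opposite , connected-opposite
  constantX : ∀ t → ConstantOn X (C t)
  constantX F.zero                 = ConstantOn-⊆ {Z = X} (λ _ Xv → Xv)
  constantX (F.suc F.zero)         = ConstantOn-⊆ {Z = X} Y_j⊆X_¬i
  constantX (F.suc (F.suc F.zero)) = ConstantOn-⊆ {Z = X} (λ _ → proj₁)
  constantY : ∀ t → ConstantOn Y (C t)
  constantY F.zero                 = ConstantOn-⊆ {Z = Y} X_i⊆Y_¬j
  constantY (F.suc F.zero)         = ConstantOn-⊆ {Z = Y} (λ _ Yv → Yv)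
  constantY (F.suc (F.suc F.zero)) = ConstantOn-⊆ {Z = Y} (λ _ → proj₂)

twoEmptyCells⇒Refines : ∀ {n} {X Y : Fin (suc n) → Bool} {i j} → Empty (part X i ∩ part Y j) →
  ¬ NonEmpty (part X (not i) ∩ part Y (not j)) → Refines X Y
twoEmptyCells⇒Refines {X = X} {Y} {i} {j} empty noOpposite {a} {b} Xa≡Xb with X a B.≟ i
... | yes Xa  = trans (onX_i a Xa) (sym (onX_i b (trans (sym Xa≡Xb) Xa)))
  where
  onX_i : part X i ⊆ part Y (not j)
  onX_i = emptyCell⇒⊆ (λ (v , cell) → empty v cell)
... | no Xa≢i = trans (onX_¬i a (BP.¬-not Xa≢i)) (sym (onX_¬i b (trans (sym Xa≡Xb) (BP.¬-not Xa≢i))))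
  where
  onX_¬i : part X (not i) ⊆ part Y j
  onX_¬i v Xv = trans (emptyCell⇒⊆ noOpposite v Xv) (BP.not-involutive j)

CommonBelt-coarsen : ∀ {n} {G : Graph n} {X Y} → Refines X Y → CommonBelt G X X → CommonBelt G X Y
CommonBelt-coarsen {G = G} {X} {Y} X⇒Y (c , codim2 , parallelX , _) =
  c , codim2 , parallelX , ParallelTo-coarsen {G = G} {X} {Y} {c} X⇒Y parallelX

connectedCells⇒CommonBelt : ∀ {n} (G : Graph n) → GraphConnected G → ∀ X Y →
  IsFacetPartition G X → IsFacetPartition G Y → 2 ≤ n → (∃[ i ] ∃[ j ] Empty (part X i ∩ part Y j)) →
  (∀ i j → NonEmpty (part X i ∩ part Y j) → InducedConnected G (part X i ∩ part Y j)) → CommonBelt G X Y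
connectedCells⇒CommonBelt G connected X Y facetX facetY 2≤n (i , j , empty) connectedCells
  with FP.any? (λ v → (X v B.≟ not i) ×-dec (Y v B.≟ not j))
... | yes opposite = oppositeCell⇒CommonBelt G connected facetX facetY empty opposite (connectedCells _ _ opposite)
... | no noOpposite = CommonBelt-coarsen {G = G} {X} {Y} (twoEmptyCells⇒Refines {X = X} {Y} empty noOpposite)
                        (CommonBelt-self G connected facetX 2≤n)

mainTheorem9 : (n : ℕ) (G : Graph n) → GraphConnected G →
    (X Y : Fin (suc n) → Bool) → IsFacetPartition G X → IsFacetPartition G Y →
    (CommonBelt G X Y → ∃[ i ] ∃[ j ] (part X i ⊆ part Y j))
    × (2 ≤ n → (∃[ i ] ∃[ j ] Empty (part X i ∩ part Y j))
    → (∀ i j → NonEmpty (part X i ∩ part Y j) → InducedConnected G (part X i ∩ part Y j))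
    → CommonBelt G X Y)
mainTheorem9 n G connected X Y facetX facetY =
  CommonBelt⇒nested G connected X Y , connectedCells⇒CommonBelt G connected X Y facetX facetY
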